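{- Let $r\in\mathbb{N}\cup\{\infty\}$, let $G$ be a graph, and let $o$ be a cycle (or more generally a closed walk) in $G$ of length at most $r$ containing vertices $a_1$ and $a_2$. Then every vertex of $o$ has a unique copy in $\mathrm{expl}(a_1,a_2)$.
   Context: For a vertex $v$ and integer $s$, the ball $B_s(v)$ is the subgraph induced by the vertices at distance at most $s$ from $v$, with all edges joining two vertices at distance exactly $s$ from $v$ removed; for a half-integer $s+\tfrac12$, $B_{s+1/2}(v)$ is the subgraph induced by the vertices at distance at most $s$ from $v$. For vertices $v,w$, the core is the set of vertices on shortest $v$–$w$ paths. The explorer-neighbourhood $\mathrm{expl}(v,w)$ (parameter $r$) is obtained by taking a copy of $B_{r/2}(v)$ in which each vertex $u$ is labelled by the set of shortest paths from the core to $u$ contained in $B_{r/2}(v)$, a similarly labelled copy of $B_{r/2}(w)$, and taking their union where two vertices are identified only if they are copies of the same vertex of $G$ with the same label. Thus a vertex of $G$ may have no, one, or two copies in $\mathrm{expl}(v,w)$. -}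

module Defs where

open import Data.Nat using (ℕ; zero; suc; _≤_; _<_)
open import Data.List using (List; []; _∷_)
open import Data.List.Membership.Propositional using (_∈_)
open import Data.List.Relation.Unary.Unique.Propositional using (Unique)
open import Data.Product using (Σ; _×_; _,_)
open import Data.Unit using (⊤)
open import Function.Bundles using (_⇔_)
open import Relation.Nullary using (¬_)

data ℕ∞ : Set where
  fin : ℕ → ℕ∞
  ∞   : ℕ∞

_≤∞_ : ℕ → ℕ∞ → Set
n ≤∞ fin m = n ≤ m
n ≤∞ ∞     = ⊤

-- radii of balls: integers s, half-integers s + 1/2, and ∞
data Radius : Set where
  int     : ℕ → Radius
  halfint : ℕ → Radius
  ∞r      : Radius

halfℕ : ℕ → Radius
halfℕ zero          = int 0
halfℕ (suc zero)    = halfint 0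
halfℕ (suc (suc n)) with halfℕ n
... | int s     = int (suc s)
... | halfint s = halfint (suc s)
... | ∞r        = ∞r

half : ℕ∞ → Radius
half (fin n) = halfℕ n
half ∞       = ∞r

record Graph : Set₁ where
  field
    V       : Set
    _~_     : V → V → Set
    ~-sym   : ∀ {x y} → x ~ y → y ~ x
    ~-irrefl : ∀ {x} → ¬ (x ~ x)

module _ (G : Graph) where
  open Graph G

  data Walk : V → V → ℕ → Set where
    []   : ∀ {x} → Walk x x 0
    step : ∀ {x y z n} → x ~ y → Walk y z n → Walk x z (suc n)

  verts : ∀ {x y n} → Walk x y n → List V
  verts ([] {x})        = x ∷ []
  verts (step {x} _ p)  = x ∷ verts p

  dist≤ : V → V → ℕ → Set
  dist≤ x y n = Σ ℕ λ m → m ≤ n × Walk x y m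

  dist≡ : V → V → ℕ → Set
  dist≡ x y n = Walk x y n × (∀ m → m < n → ¬ Walk x y m)

  connected : V → V → Set
  connected x y = Σ ℕ λ m → Walk x y m

  BallV : V → Radius → V → Set
  BallV v (int s)     x = dist≤ v x s
  BallV v (halfint s) x = dist≤ v x s
  BallV v ∞r          x = connected v x

  BallE : V → Radius → V → V → Set
  BallE v (int s) x y =
    BallV v (int s) x × BallV v (int s) y × x ~ y × ¬ (dist≡ v x s × dist≡ v y s)
  BallE v (halfint s) x y = BallV v (halfint s) x × BallV v (halfint s) y × x ~ y
  BallE v ∞r x y = BallV v ∞r x × BallV v ∞r y × x ~ y

  InBall : V → Radius → ∀ {x y n} → Walk x y n → Set
  InBall v ρ ([] {x})           = BallV v ρ x
  InBall v ρ (step {x} {y} _ p) = BallV v ρ x × BallE v ρ x y × InBall v ρ p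

  Core : V → V → V → Set
  Core v w x = Σ ℕ λ k → dist≡ v w k × Σ (Walk v w k) λ p → x ∈ verts p

  PathTo : V → Set
  PathTo u = Σ V λ c → Σ ℕ λ k → Walk c u k

  ShortestCorePath : V → V → (u : V) → PathTo u → Set
  ShortestCorePath v w u (c , k , p) =
    Core v w c × Unique (verts p) ×
    (∀ c' → Core v w c' → ∀ m → m < k → ¬ Walk c' u m)

  data Side : Set where
    left right : Side

  centre : V → V → Side → V
  centre v w left  = v
  centre v w right = w

  -- a copy of u in expl(v,w) (parameter r): a copy coming from B_{r/2}(v)
  -- or from B_{r/2}(w)
  Copy : ℕ∞ → V → V → V → Set
  Copy r v w u = Σ Side λ s → BallV (centre v w s) (half r) u

  -- label of a copy: the set of shortest core–u paths contained in that ball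
  label : ∀ r v w u → Copy r v w u → PathTo u → Set
  label r v w u (s , _) P =
    ShortestCorePath v w u P × InBall (centre v w s) (half r) (Σ.proj₂ (Σ.proj₂ P))

  Identified : ∀ r v w u → Copy r v w u → Copy r v w u → Set
  Identified r v w u c c' = ∀ P → label r v w u c P ⇔ label r v w u c' P

  HasUniqueCopy : ℕ∞ → V → V → V → Set
  HasUniqueCopy r v w u =
    Copy r v w u × (∀ c c' → Identified r v w u c c')

module Submission where

-- Cut the closed walk o (length n ≤ r) at a₁, a₂ and u: this
-- yields a "triangle" of walks a₁ → a₂ → u → a₁ whose total length is at
-- most n.  Everything then follows from one metric fact: a vertex, or a whole
-- walk, lying on a closed walk through a of length at most 2ρ lies in the
-- ball B_ρ(a); the edge condition of integer radii holds because two
-- adjacent vertices on such a walk cannot both be at distance exactly ρ.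
--   * u itself lies on the triangle, a closed walk through a₁, so u has a
--     copy in B_{r/2}(a₁).
--   * A shortest path p from a core vertex c to u has length at most the
--     triangle sides a₂ → u and u → a₁ (a₁, a₂ are core vertices), and c cuts
--     a shortest a₁–a₂ path, which is no longer than the side a₁ → a₂.  So
--     a₁ → c, then p, then u → a₁ is a closed walk of length ≤ n ≤ 2·(r/2),
--     and p lies in B_{r/2}(a₁); symmetrically p lies in B_{r/2}(a₂).
--     Hence every copy of u carries the same label: all copies coincide.

open import Defs
open import Data.Nat using (ℕ; zero; suc; _+_; _≤_; s≤s; _≤?_)
open import Data.Nat.Properties
open import Data.List.Membership.Propositional using (_∈_)
open import Data.List.Relation.Unary.Any using (here; there)
open import Data.Product using (Σ; _×_; _,_; proj₂)
open import Data.Sum using (_⊎_; inj₁; inj₂)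
open import Data.Unit using (⊤; tt)
open import Function.Bundles using (mk⇔)
open import Relation.Binary.PropositionalEquality
  using (_≡_; refl; sym; trans; subst; cong; module ≡-Reasoning)
open import Relation.Nullary using (¬_; yes; no)

_≤twice_ : ℕ → Radius → Set
n ≤twice int s     = n ≤ s + s
n ≤twice halfint s = n ≤ suc (s + s)
n ≤twice ∞r        = ⊤

twice-halfℕ : ∀ m → m ≤twice halfℕ m
twice-halfℕ zero          = ≤-refl
twice-halfℕ (suc zero)    = ≤-refl
twice-halfℕ (suc (suc m)) with halfℕ m | twice-halfℕ m
... | int s     | m≤ = s≤s (≤-trans (s≤s m≤) (≤-reflexive (sym (+-suc s s))))
... | halfint s | m≤ = s≤s (s≤s (≤-trans m≤ (≤-reflexive (sym (+-suc s s)))))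
... | ∞r        | _  = tt

≤twice-mono : ∀ {n m ρ} → n ≤ m → m ≤twice ρ → n ≤twice ρ
≤twice-mono {ρ = int s}     n≤m m≤ = ≤-trans n≤m m≤
≤twice-mono {ρ = halfint s} n≤m m≤ = ≤-trans n≤m m≤
≤twice-mono {ρ = ∞r}        _   _  = tt

≤twice-half : ∀ {n} r → n ≤∞ r → n ≤twice half r
≤twice-half (fin m) n≤m = ≤twice-mono n≤m (twice-halfℕ m)
≤twice-half ∞       _   = tt

move-step : ∀ {t b n} → t + suc b ≤ n → t + 1 + b ≤ n
move-step {t} {b} {n} = subst (_≤ n) (sym (+-assoc t 1 b))

split-sum : ∀ s {t b} → t + b ≤ suc (s + s) → t ≤ s ⊎ b ≤ s
split-sum s {t} {b} t+b≤ with t ≤? s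
... | yes t≤s = inj₁ t≤s
... | no  t≰s = inj₂ (+-cancelˡ-≤ (suc s) b s (≤-trans (+-monoˡ-≤ b (≰⇒> t≰s)) t+b≤))

module _ (G : Graph) where
  open Graph G

  _++_ : ∀ {x y z m k} → Walk G x y m → Walk G y z k → Walk G x z (m + k)
  []         ++ q = q
  step e p   ++ q = step e (p ++ q)

  rev : ∀ {x y m} → Walk G x y m → Walk G y x m
  rev []                     = []
  rev {m = suc m} (step e p) =
    subst (Walk G _ _) (+-comm m 1) (rev p ++ step (~-sym e) [])

  head∈ : ∀ {x y m} (p : Walk G x y m) → x ∈ verts G p
  head∈ []         = here refl
  head∈ (step e p) = here refl

  last∈ : ∀ {x y m} (p : Walk G x y m) → y ∈ verts G p
  last∈ []         = here refl
  last∈ (step e p) = there (last∈ p)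

  ∈-++ˡ : ∀ {x y z m k w} (p : Walk G x y m) (q : Walk G y z k) →
    w ∈ verts G p → w ∈ verts G (p ++ q)
  ∈-++ˡ []         q (here refl) = head∈ q
  ∈-++ˡ (step e p) q (here refl) = here refl
  ∈-++ˡ (step e p) q (there w∈)  = there (∈-++ˡ p q w∈)

  ∈-++ʳ : ∀ {x y z m k w} (p : Walk G x y m) (q : Walk G y z k) →
    w ∈ verts G q → w ∈ verts G (p ++ q)
  ∈-++ʳ []         q w∈ = w∈
  ∈-++ʳ (step e p) q w∈ = there (∈-++ʳ p q w∈)

  verts-subst : ∀ {x y m m'} (eq : m ≡ m') (p : Walk G x y m) →
    verts G (subst (Walk G x y) eq p) ≡ verts G p
  verts-subst refl p = refl

  record Split {x y n} (o : Walk G x y n) (v : V) : Set where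
    field
      {i j}   : ℕ
      pre     : Walk G x v i
      suf     : Walk G v y j
      lengths : i + j ≡ n
      covers  : ∀ {z} → z ∈ verts G o → z ∈ verts G pre ⊎ z ∈ verts G suf

  split : ∀ {x y n v} (o : Walk G x y n) → v ∈ verts G o → Split o v
  split []         (here refl) = record { pre = [] ; suf = [] ; lengths = refl ; covers = inj₁ }
  split (step e o) (here refl) = record { pre = [] ; suf = step e o ; lengths = refl ; covers = inj₂ }
  split (step e o) (there v∈)  = record
    { pre = step e pre ; suf = suf ; lengths = cong suc lengths ; covers = covers' }
    where
    open Split (split o v∈)
    covers' : ∀ {z} → z ∈ verts G (step e o) → z ∈ verts G (step e pre) ⊎ z ∈ verts G suf
    covers' (here refl) = inj₁ (here refl)
    covers' (there z∈) with covers z∈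
    ... | inj₁ z∈pre = inj₁ (there z∈pre)
    ... | inj₂ z∈suf = inj₂ z∈suf

  rotate : ∀ {x n a} (o : Walk G x x n) → a ∈ verts G o →
    Σ (Walk G a a n) λ o' → ∀ {z} → z ∈ verts G o → z ∈ verts G o'
  rotate {a = a} o a∈ = subst (Walk G a a) len (suf ++ pre) , covers'
    where
    open Split (split o a∈)
    len = trans (+-comm j i) lengths
    covers' : ∀ {z} → z ∈ verts G o → z ∈ verts G (subst (Walk G a a) len (suf ++ pre))
    covers' z∈ rewrite verts-subst len (suf ++ pre) with covers z∈
    ... | inj₁ z∈pre = ∈-++ʳ suf pre z∈pre
    ... | inj₂ z∈suf = ∈-++ˡ suf pre z∈suf

  record Triangle (a₁ a₂ u : V) (n : ℕ) : Set where
    field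
      {ℓ₁₂ ℓ₂ᵤ ℓᵤ₁} : ℕ
      side₁₂    : Walk G a₁ a₂ ℓ₁₂
      side₂ᵤ    : Walk G a₂ u ℓ₂ᵤ
      sideᵤ₁    : Walk G u a₁ ℓᵤ₁
      perimeter : ℓ₁₂ + ℓ₂ᵤ + ℓᵤ₁ ≤ n

  -- Cutting a closed walk at a₁ through a₂ and u at these two vertices gives
  -- a triangle; if u precedes a₂ the pieces are traversed backwards.
  triangle : ∀ {a₁ a₂ u n} (o : Walk G a₁ a₁ n) → a₂ ∈ verts G o → u ∈ verts G o →
    Triangle a₁ a₂ u n
  triangle o a₂∈ u∈ with Split.covers (split o a₂∈) u∈
  ... | inj₂ u∈suf = record
    { side₁₂ = pre ; side₂ᵤ = S.pre ; sideᵤ₁ = S.suf ; perimeter = ≤-reflexive len }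
    where
    open Split (split o a₂∈)
    module S = Split (split suf u∈suf)
    open ≡-Reasoning
    len : i + S.i + S.j ≡ _
    len = begin
      i + S.i + S.j   ≡⟨ +-assoc i S.i S.j ⟩
      i + (S.i + S.j) ≡⟨ cong (i +_) S.lengths ⟩
      i + j           ≡⟨ lengths ⟩
      _               ∎
  ... | inj₁ u∈pre = record
    { side₁₂ = rev suf ; side₂ᵤ = rev S.suf ; sideᵤ₁ = rev S.pre ; perimeter = ≤-reflexive len }
    where
    open Split (split o a₂∈)
    module S = Split (split pre u∈pre)
    open ≡-Reasoning
    len : j + S.j + S.i ≡ _
    len = begin
      j + S.j + S.i   ≡⟨ +-assoc j S.j S.i ⟩
      j + (S.j + S.i) ≡⟨ cong (j +_) (trans (+-comm S.j S.i) S.lengths) ⟩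
      j + i           ≡⟨ trans (+-comm j i) lengths ⟩
      _               ∎

  on-closed-walk : ∀ {a y t b} s → Walk G a y t → Walk G y a b →
    t + b ≤ suc (s + s) → dist≤ G a y s
  on-closed-walk s A B t+b≤ with split-sum s t+b≤
  ... | inj₁ t≤s = _ , t≤s , A
  ... | inj₂ b≤s = _ , b≤s , rev B

  ball-vertex : ∀ {n ρ a y t b} → n ≤twice ρ → Walk G a y t → Walk G y a b →
    t + b ≤ n → BallV G a ρ y
  ball-vertex {ρ = int s}     n≤ A B t+b≤ = on-closed-walk s A B (≤-trans t+b≤ (m≤n⇒m≤1+n n≤))
  ball-vertex {ρ = halfint s} n≤ A B t+b≤ = on-closed-walk s A B (≤-trans t+b≤ n≤)
  ball-vertex {ρ = ∞r}        _  A B _    = _ , A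

  not-both-on-sphere : ∀ {a y z t b} s → Walk G a y t → Walk G z a b →
    t + suc b ≤ s + s → ¬ (dist≡ G a y s × dist≡ G a z s)
  not-both-on-sphere {t = t} {b} s A B t+1+b≤ (y-on , z-on)
    with split-sum s {suc t} {suc b} (s≤s t+1+b≤)
  ... | inj₁ t<s = proj₂ y-on t t<s A
  ... | inj₂ b<s = proj₂ z-on b b<s (rev B)

  ball-edge-ends : ∀ {n ρ a y z t b} → n ≤twice ρ → y ~ z → Walk G a y t → Walk G z a b →
    t + suc b ≤ n → BallV G a ρ y × BallV G a ρ z
  ball-edge-ends n≤ e A B t+1+b≤ =
    ball-vertex n≤ A (step e B) t+1+b≤ , ball-vertex n≤ (A ++ step e []) B (move-step t+1+b≤)

  ball-edge : ∀ {n ρ a y z t b} → n ≤twice ρ → y ~ z → Walk G a y t → Walk G z a b →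
    t + suc b ≤ n → BallE G a ρ y z
  ball-edge {ρ = int s} n≤ e A B t+1+b≤ =
    let (y∈ , z∈) = ball-edge-ends {ρ = int s} n≤ e A B t+1+b≤
    in y∈ , z∈ , e , not-both-on-sphere s A B (≤-trans t+1+b≤ n≤)
  ball-edge {ρ = halfint s} n≤ e A B t+1+b≤ =
    let (y∈ , z∈) = ball-edge-ends {ρ = halfint s} n≤ e A B t+1+b≤ in y∈ , z∈ , e
  ball-edge {ρ = ∞r} n≤ e A B t+1+b≤ =
    let (y∈ , z∈) = ball-edge-ends {ρ = ∞r} n≤ e A B t+1+b≤ in y∈ , z∈ , e

  walk-in-ball : ∀ {n ρ a y u j t ℓ} → n ≤twice ρ → (q : Walk G y u j) →
    Walk G a y t → Walk G u a ℓ → t + (j + ℓ) ≤ n → InBall G a ρ q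
  walk-in-ball n≤ []         A R len≤ = ball-vertex n≤ A R len≤
  walk-in-ball n≤ (step e q) A R len≤ =
    ball-vertex n≤ A (step e q ++ R) len≤ ,
    ball-edge n≤ e A (q ++ R) len≤ ,
    walk-in-ball n≤ q (A ++ step e []) R (move-step len≤)

  closed-walk-triangle : ∀ {x n a₁ a₂ u} (o : Walk G x x n) →
    a₁ ∈ verts G o → a₂ ∈ verts G o → u ∈ verts G o → Triangle a₁ a₂ u n
  closed-walk-triangle o a₁∈ a₂∈ u∈ with rotate o a₁∈
  ... | o' , covers = triangle o' (covers a₂∈) (covers u∈)

  triangle-corner-in-ball : ∀ {n ρ a₁ a₂ u} → n ≤twice ρ → Triangle a₁ a₂ u n →
    BallV G a₁ ρ u
  triangle-corner-in-ball n≤ T = ball-vertex n≤ (side₁₂ ++ side₂ᵤ) sideᵤ₁ perimeter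
    where open Triangle T

  core-ends : ∀ {v w c} → Core G v w c → Core G v w v × Core G v w w
  core-ends (K , dK , pK , _) = (K , dK , pK , head∈ pK) , (K , dK , pK , last∈ pK)

  -- A core vertex c cuts a shortest v–w path, so it lies on a route
  -- v → c → w no longer than any v–w walk.
  core-route : ∀ {v w c m} → Core G v w c → Walk G v w m →
    Σ ℕ λ i → Σ ℕ λ j → Walk G v c i × Walk G c w j × i + j ≤ m
  core-route (K , (_ , shortest) , pK , c∈) W =
    i , j , pre , suf , ≤-trans (≤-reflexive lengths) (≮⇒≥ λ m<K → shortest _ m<K W)
    where open Split (split pK c∈)

  core-path-shortest : ∀ {v w u c k c' m} {p : Walk G c u k} →
    ShortestCorePath G v w u (c , k , p) → Core G v w c' → Walk G c' u m → k ≤ m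
  core-path-shortest (_ , _ , minimal) core' W = ≮⇒≥ λ m<k → minimal _ core' _ m<k W

  core-path-in-balls : ∀ {n ρ a₁ a₂ u c k} → n ≤twice ρ → Triangle a₁ a₂ u n →
    (p : Walk G c u k) → ShortestCorePath G a₁ a₂ u (c , k , p) →
    ∀ side → InBall G (centre G a₁ a₂ side) ρ p
  core-path-in-balls {k = k} n≤ T p scp@(core , _) side
    with core-ends core | core-route core (Triangle.side₁₂ T)
  ... | core₁ , core₂ | i , j , pre , suf , i+j≤ = in-ball side
    where
    open Triangle T
    k≤ℓ₂ᵤ : k ≤ ℓ₂ᵤ
    k≤ℓ₂ᵤ = core-path-shortest scp core₂ side₂ᵤ
    k≤ℓᵤ₁ : k ≤ ℓᵤ₁
    k≤ℓᵤ₁ = core-path-shortest scp core₁ (rev sideᵤ₁)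
    i≤ℓ₁₂ : i ≤ ℓ₁₂
    i≤ℓ₁₂ = ≤-trans (m≤m+n i j) i+j≤
    j≤ℓ₁₂ : j ≤ ℓ₁₂
    j≤ℓ₁₂ = ≤-trans (m≤n+m j i) i+j≤
    -- a₁ → c → u → a₁ and a₂ → c → u → a₂ are no longer than the triangle.
    left-loop : i + (k + ℓᵤ₁) ≤ _
    left-loop = ≤-trans (+-mono-≤ i≤ℓ₁₂ (+-monoˡ-≤ ℓᵤ₁ k≤ℓ₂ᵤ))
                        (≤-trans (≤-reflexive (sym (+-assoc ℓ₁₂ ℓ₂ᵤ ℓᵤ₁))) perimeter)
    right-loop : j + (k + ℓ₂ᵤ) ≤ _
    right-loop = ≤-trans (+-mono-≤ j≤ℓ₁₂ (+-monoˡ-≤ ℓ₂ᵤ k≤ℓᵤ₁))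
                         (≤-trans (≤-reflexive (trans (cong (ℓ₁₂ +_) (+-comm ℓᵤ₁ ℓ₂ᵤ))
                                                      (sym (+-assoc ℓ₁₂ ℓ₂ᵤ ℓᵤ₁))))
                                  perimeter)
    in-ball : ∀ side → InBall G (centre G _ _ side) _ p
    in-ball left  = walk-in-ball n≤ p pre sideᵤ₁ left-loop
    in-ball right = walk-in-ball n≤ p (rev suf) (rev side₂ᵤ) right-loop

-- u has a copy in the ball around a₁, and since every shortest core path to u
-- lies in both balls, all copies carry the same label.
lemma4p2 : (r : ℕ∞) (G : Graph) (x : Graph.V G) (n : ℕ) (o : Walk G x x n) →
    n ≤∞ r → (a₁ a₂ : Graph.V G) → a₁ ∈ verts G o → a₂ ∈ verts G o →
    ∀ u → u ∈ verts G o → HasUniqueCopy G r a₁ a₂ u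
lemma4p2 r G x n o n≤r a₁ a₂ a₁∈ a₂∈ u u∈ =
  (left , triangle-corner-in-ball G n≤ T) , λ c c' P → mk⇔ (same-label {c} c' P) (same-label {c'} c P)
  where
  n≤ : n ≤twice half r
  n≤ = ≤twice-half r n≤r
  T : Triangle G a₁ a₂ u n
  T = closed-walk-triangle G o a₁∈ a₂∈ u∈
  same-label : ∀ {c} c' P → label G r a₁ a₂ u c P → label G r a₁ a₂ u c' P
  same-label (side , _) (_ , _ , p) (scp , _) = scp , core-path-in-balls G n≤ T p scp side
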